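{- Let $D=(V,A)$ be a bidirected directed graph without loops, let $L$ be a finite set, let $s\in V$, and let $f: A\times (2^L\setminus\{\emptyset\})\to R$ be an $s$-oriented mirror function, where $R$ is a ring of characteristic two. Then \[ \Lambda(D,L,f)=\sum_{H\in hc(D)}\ \sum_{g:L\twoheadrightarrow H}\ \prod_{a\in H} f(a,g^{ -1}(a)). \]
   Context: A cycle cover of a directed graph $D=(V,A)$ is a subset $C\subseteq A$ such that every vertex of $V$ is the start of exactly one arc of $C$ and the end of exactly one arc of $C$; $cc(D)$ is the set of all cycle covers, and $hc(D)\subseteq cc(D)$ is the set of Hamiltonian cycle covers, i.e. those consisting of a single cycle through all vertices. For a finite set $L$ and $f:A\times(2^L\setminus\{\emptyset\})\to R$ ($R$ a ring), the Labeled Cycle Cover Sum is \[\Lambda(D,L,f)=\sum_{C\in cc(D)}\ \sum_{g:L\twoheadrightarrow C}\ \prod_{a\in C} f(a,g^{ -1}(a)),\] where $g$ ranges over surjective functions from $L$ onto $C$ and $g^{ -1}(a)=\{\ell\in L: g(\ell)=a\}$. $D$ is bidirected if for every arc $uv\in A$ the arc $vu$ is also in $A$. For $s\in V$, $f$ is an $s$-oriented mirror function if $f(uv,Z)=f(vu,Z)$ for all nonempty $Z\subseteq L$ and all arcs $uv$ with $u\neq s$ and $v\neq s$. -}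

module Defs where

open import Level using (Level)
open import Data.Nat using (ℕ; zero; suc)
open import Data.Bool using (Bool; true; false)
import Data.Bool as B
open import Data.Fin using (Fin; _≟_)
open import Data.Fin.Subset using (Subset; Nonempty)
open import Data.Fin.Properties using (all?; any?)
open import Data.List using (List; []; _∷_; [_]; map; concatMap; foldr; filter; allFin)
open import Data.Vec using (tabulate)
import Data.Vec.Functional as VF
open import Data.Product using (_×_; ∃; _,_)
open import Function using (_∘_)
open import Relation.Nullary using (Dec; ¬_; does)
open import Relation.Nullary.Decidable using (_×-dec_; _→-dec_)
open import Relation.Binary.PropositionalEquality using (_≡_)
open import Algebra.Bundles using (CommutativeRing)

Digraph : ℕ → Set
Digraph n = Fin n → Fin n → Bool

Loopless : ∀ {n} → Digraph n → Set
Loopless {n} adj = ∀ (v : Fin n) → adj v v ≡ false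

Bidirected : ∀ {n} → Digraph n → Set
Bidirected {n} adj = ∀ (u v : Fin n) → adj u v ≡ true → adj v u ≡ true

-- A set C of arcs in which every vertex is the start of
-- exactly one arc is the same as a successor function σ : V → V with
-- (v , σ v) ∈ A for all v (C = { v(σ v) }); every vertex is the end of
-- exactly one arc of C iff σ is injective and surjective.

IsCycleCover : ∀ {n} → Digraph n → (Fin n → Fin n) → Set
IsCycleCover {n} adj σ =
  (∀ v → adj v (σ v) ≡ true)
  × (∀ u v → σ u ≡ σ v → u ≡ v)
  × (∀ w → ∃ λ v → σ v ≡ w)

isCycleCover? : ∀ {n} (adj : Digraph n) (σ : Fin n → Fin n) → Dec (IsCycleCover adj σ)
isCycleCover? adj σ =
  all? (λ v → adj v (σ v) B.≟ true)
  ×-dec all? (λ u → all? (λ v → (σ u ≟ σ v) →-dec (u ≟ v)))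
  ×-dec all? (λ w → any? (λ v → σ v ≟ w))

iter : ∀ {n} → (Fin n → Fin n) → ℕ → Fin n → Fin n
iter σ zero    u = u
iter σ (suc i) u = σ (iter σ i u)

-- A (cycle cover given by) σ is Hamiltonian iff it is a single cycle,
-- i.e. every vertex v is reached from every vertex u by following arcs
-- of the cover (fewer than n steps suffice, so i ranges over Fin n).
IsHamiltonian : ∀ {n} → (Fin n → Fin n) → Set
IsHamiltonian {n} σ = ∀ (u v : Fin n) → ∃ λ (i : Fin n) → iter σ (Data.Fin.toℕ i) u ≡ v

isHamiltonian? : ∀ {n} (σ : Fin n → Fin n) → Dec (IsHamiltonian σ)
isHamiltonian? σ = all? (λ u → all? (λ v → any? (λ i → iter σ (Data.Fin.toℕ i) u ≟ v)))

Surjective : ∀ {k n} → (Fin k → Fin n) → Set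
Surjective {k} {n} g = ∀ (w : Fin n) → ∃ λ (l : Fin k) → g l ≡ w

surjective? : ∀ {k n} (g : Fin k → Fin n) → Dec (Surjective g)
surjective? g = all? (λ w → any? (λ l → g l ≟ w))

preimage : ∀ {k n} → (Fin k → Fin n) → Fin n → Subset k
preimage g v = tabulate (λ l → does (g l ≟ v))

allFuns : (n m : ℕ) → List (Fin n → Fin m)
allFuns zero    m = [ (λ ()) ]
allFuns (suc n) m = concatMap (λ i → map (i VF.∷_) (allFuns n m)) (allFin m)

module _ {c ℓ : Level} (R : CommutativeRing c ℓ) where
  open CommutativeRing R

  CharTwo : Set ℓ
  CharTwo = 1# + 1# ≈ 0#

  -- f : A × (2^L ∖ {∅}) → R, encoded as f u v Z for the arc uv and
  -- the label set Z; values at non-arcs or Z = ∅ are never used.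
  -- s-oriented mirror function:
  MirrorFunction : ∀ {n k} → Digraph n → Fin n → (Fin n → Fin n → Subset k → Carrier) → Set ℓ
  MirrorFunction {n} {k} adj s f =
    ∀ (u v : Fin n) → adj u v ≡ true → ¬ (u ≡ s) → ¬ (v ≡ s) →
    ∀ (Z : Subset k) → Nonempty Z → f u v Z ≈ f v u Z

  sumL : ∀ {a} {X : Set a} → List X → (X → Carrier) → Carrier
  sumL xs h = foldr (λ x r → h x + r) 0# xs

  prodFin : ∀ {n} → (Fin n → Carrier) → Carrier
  prodFin {n} h = foldr (λ x r → h x * r) 1# (allFin n)

  -- Σ_{g : L ↠ C} Π_{a ∈ C} f(a, g⁻¹(a)), arcs of C indexed by their start vertex
  labelSum : ∀ {n} (k : ℕ) → (Fin n → Fin n → Subset k → Carrier) → (Fin n → Fin n) → Carrier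
  labelSum {n} k f σ =
    sumL (filter surjective? (allFuns k n)) (λ g → prodFin (λ v → f v (σ v) (preimage g v)))

  Λ : ∀ {n} (k : ℕ) → Digraph n → (Fin n → Fin n → Subset k → Carrier) → Carrier
  Λ {n} k adj f = sumL (filter (isCycleCover? adj) (allFuns n n)) (labelSum k f)

  HamΛ : ∀ {n} (k : ℕ) → Digraph n → (Fin n → Fin n → Subset k → Carrier) → Carrier
  HamΛ {n} k adj f =
    sumL (filter (λ σ → isCycleCover? adj σ ×-dec isHamiltonian? σ) (allFuns n n)) (labelSum k f)

module Submission where

-- The difference Λ − HamΛ is the sum of
-- the weights Π_v f(v, σ v, g⁻¹ v) over the pairs (σ , g) with σ a cycle
-- cover that is not Hamiltonian and g : L ↠ V.  For such σ the pivot c is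
-- the least vertex not on the cycle of s; reversing the cycle T of σ
-- through c, and moving each label from an arc of T to the reversed arc,
-- gives a pair of the same kind with the same pivot and the same T, hence
-- an involution.  It preserves weights by the mirror property (T avoids s)
-- and has no fixed points (σ moves every vertex, D being loopless), so the
-- sum vanishes in characteristic two.

open import Defs
open import Level using (Level)
open import Algebra.Bundles using (Monoid; CommutativeRing)
import Algebra.Properties.Monoid.Sum as MonoidSum
import Relation.Binary.Reasoning.Setoid as SetoidReasoning
open import Data.Bool using (Bool; true; false; if_then_else_; not; _∧_; T)
open import Data.Bool.Properties using (if-∧)
open import Data.Nat as ℕ using (ℕ; zero; suc; _∸_)
import Data.Nat.Properties as ℕP
open import Data.Nat.Induction using (<-rec)
open import Data.Fin using (Fin; zero; suc; toℕ; fromℕ<; _≟_; _↑ˡ_; _↑ʳ_; combine; quotient; remainder; funToFin; finToFun)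
import Data.Fin as Fin
import Data.Fin.Properties as FinP
open import Data.Fin.Properties using (any?; pigeonhole; _<?_; <-cmp; remQuot-combine; combine-remQuot; funToFin-finToFin; finToFun-funToFin)
open import Data.Fin.Permutation using (permutation)
open import Data.Fin.Subset using (Subset; Nonempty)
open import Data.List as List using (List; []; _∷_; _++_; map; concatMap; filter; allFin)
open import Data.Maybe as Maybe using (Maybe; just; nothing; is-just)
open import Data.Product using (_×_; _,_; proj₁; proj₂; ∃)
import Data.Vec.Functional as VF
open import Data.Vec.Properties using (tabulate-cong; lookup∘tabulate; lookup⇒[]=)
open import Function using (_∘_; id; _⇔_; mk⇔)
open import Function.Construct.Composition using (_⇔-∘_)
open import Function.Construct.Symmetry using (⇔-sym)
open import Relation.Binary using (tri<; tri≈; tri>)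
open import Relation.Binary.PropositionalEquality using (_≡_; _≗_; refl; sym; trans; cong; cong₂; subst)
open import Relation.Nullary using (Dec; yes; no; does; ¬_; contradiction)
open import Relation.Nullary.Decidable using (dec-true; dec-false; does-⇔; T?; _×-dec_)

if-true : ∀ {a} {A : Set a} {b : Bool} {x y : A} → b ≡ true → (if b then x else y) ≡ x
if-true refl = refl

if-false : ∀ {a} {A : Set a} {b : Bool} {x y : A} → b ≡ false → (if b then x else y) ≡ y
if-false refl = refl

Reach : ∀ {n} → (Fin n → Fin n) → Fin n → Fin n → Set
Reach {n} φ u v = ∃ λ (i : Fin n) → iter φ (toℕ i) u ≡ v

reach? : ∀ {n} (φ : Fin n → Fin n) (u v : Fin n) → Dec (Reach φ u v)
reach? φ u v = any? (λ i → iter φ (toℕ i) u ≟ v)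

module _ {n : ℕ} (φ : Fin n → Fin n) where

  open import Data.Nat using (_+_; _*_)

  iter-+ : ∀ i j u → iter φ (i + j) u ≡ iter φ i (iter φ j u)
  iter-+ zero    j u = refl
  iter-+ (suc i) j u = cong φ (iter-+ i j u)

  iter-suc : ∀ i u → iter φ (suc i) u ≡ iter φ i (φ u)
  iter-suc i u = trans (cong (λ j → iter φ j u) (ℕP.+-comm 1 i)) (iter-+ i 1 u)

  -- Any number of steps can be shortened below n: among the first n + 1
  -- points of the orbit two coincide (pigeonhole), and the loop between
  -- them can be cut out.
  shorten : ∀ i {u v} → iter φ i u ≡ v → Reach φ u v
  shorten i {u} {v} = <-rec (λ i → iter φ i u ≡ v → Reach φ u v) step i
    where
    step : ∀ i → (∀ {j} → j ℕ.< i → iter φ j u ≡ v → Reach φ u v) → iter φ i u ≡ v → Reach φ u v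
    step i rec e with i ℕ.<? n
    ... | yes i<n = fromℕ< i<n , trans (cong (λ j → iter φ j u) (FinP.toℕ-fromℕ< i<n)) e
    ... | no i≮n with pigeonhole (ℕP.n<1+n n) (λ (a : Fin (suc n)) → iter φ (toℕ a) u)
    ... | a , b , a<b , loop = rec shorter (trans cut (trans (cong (λ j → iter φ j u) i≡) e))
      where
      d : ℕ
      d = i ∸ toℕ b
      i≡ : d + toℕ b ≡ i
      i≡ = ℕP.m∸n+n≡m (ℕP.≤-trans (FinP.toℕ≤pred[n] b) (ℕP.≮⇒≥ i≮n))
      shorter : d + toℕ a ℕ.< i
      shorter = subst (d + toℕ a ℕ.<_) i≡ (ℕP.+-monoʳ-< d a<b)
      cut : iter φ (d + toℕ a) u ≡ iter φ (d + toℕ b) u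
      cut = trans (iter-+ d (toℕ a) u) (trans (cong (iter φ d) loop) (sym (iter-+ d (toℕ b) u)))

  reach-refl : ∀ u → Reach φ u u
  reach-refl u = shorten 0 refl

  reach-step : ∀ {u v} → Reach φ u v → Reach φ u (φ v)
  reach-step (i , e) = shorten (suc (toℕ i)) (cong φ e)

  reach-trans : ∀ {u v w} → Reach φ u v → Reach φ v w → Reach φ u w
  reach-trans {u} (i , e) (j , e′) =
    shorten (toℕ j + toℕ i) (trans (iter-+ (toℕ j) (toℕ i) u) (trans (cong (iter φ (toℕ j)) e) e′))

  -- For injective φ every orbit is a cycle, so reachability is symmetric.
  module _ (inj : ∀ x y → φ x ≡ φ y → x ≡ y) where

    iter-injective : ∀ i {x y} → iter φ i x ≡ iter φ i y → x ≡ y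
    iter-injective zero    e = e
    iter-injective (suc i) e = iter-injective i (inj _ _ e)

    periodic : ∀ u → ∃ λ p → iter φ (suc p) u ≡ u
    periodic u with pigeonhole (ℕP.n<1+n n) (λ (a : Fin (suc n)) → iter φ (toℕ a) u)
    ... | a , b , a<b , loop = p , sym (iter-injective (toℕ a) (trans loop split))
      where
      p : ℕ
      p = toℕ b ∸ suc (toℕ a)
      split : iter φ (toℕ b) u ≡ iter φ (toℕ a) (iter φ (suc p) u)
      split = trans (cong (λ j → iter φ j u) (sym (trans (ℕP.+-suc (toℕ a) p) (ℕP.m+[n∸m]≡n a<b))))
                    (iter-+ (toℕ a) (suc p) u)

    iter-period : ∀ {p u} → iter φ (suc p) u ≡ u → ∀ m → iter φ (m * suc p) u ≡ u
    iter-period         per zero    = refl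
    iter-period {p} {u} per (suc m) =
      trans (iter-+ (suc p) (m * suc p) u) (trans (cong (iter φ (suc p)) (iter-period per m)) per)

    -- going round the cycle of u (i times its length) and back by i steps
    reach-sym : ∀ {u v} → Reach φ u v → Reach φ v u
    reach-sym {u} {v} (i , e) with periodic u
    ... | p , per = shorten (toℕ i * p) back
      where
      back : iter φ (toℕ i * p) v ≡ u
      back = trans (cong (iter φ (toℕ i * p)) (sym e))
             (trans (sym (iter-+ (toℕ i * p) (toℕ i) u))
             (trans (cong (λ j → iter φ j u) (trans (ℕP.+-comm (toℕ i * p) (toℕ i)) (sym (ℕP.*-suc (toℕ i) p))))
                    (iter-period per (toℕ i))))

module _ {n : ℕ} {φ ψ : Fin n → Fin n} {u : Fin n}
         (agree : ∀ i → ψ (iter φ i u) ≡ φ (iter φ i u)) where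

  iter-agree : ∀ i → iter ψ i u ≡ iter φ i u
  iter-agree zero    = refl
  iter-agree (suc i) = trans (cong ψ (iter-agree i)) (agree i)

  reach-agree : ∀ {v} → Reach φ u v ⇔ Reach ψ u v
  reach-agree = mk⇔ (λ (i , e) → i , trans (iter-agree (toℕ i)) e)
                    (λ (i , e) → i , trans (sym (iter-agree (toℕ i))) e)

-- If φ is injective and φ ∘ ψ = id, the orbits of ψ lie in those of φ:
-- going from u to v along ψ is going from v back to u along φ.
reach-inverse : ∀ {n} {φ ψ : Fin n → Fin n} → (∀ v → φ (ψ v) ≡ v) →
                (∀ x y → φ x ≡ φ y → x ≡ y) → ∀ {u v} → Reach ψ u v → Reach φ u v
reach-inverse {φ = φ} {ψ} inv inj {u} (i , e) =
  reach-sym φ inj (shorten φ (toℕ i) (trans (cong (iter φ (toℕ i)) (sym e)) (cancel (toℕ i) u)))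
  where
  cancel : ∀ i x → iter φ i (iter ψ i x) ≡ x
  cancel zero    x = refl
  cancel (suc i) x = trans (iter-suc φ i (ψ (iter ψ i x))) (trans (cong (iter φ i) (inv _)) (cancel i x))

-- Permutations.  IsPerm σ is the injectivity and surjectivity part of
-- IsCycleCover; pre σ picks a preimage, which for a permutation is σ⁻¹.

IsPerm : ∀ {n} → (Fin n → Fin n) → Set
IsPerm {n} σ = (∀ u v → σ u ≡ σ v → u ≡ v) × Surjective σ

surjective-cong : ∀ {k n} {g h : Fin k → Fin n} → g ≗ h → Surjective g → Surjective h
surjective-cong e sur w = proj₁ (sur w) , trans (sym (e _)) (proj₂ (sur w))

perm-cong : ∀ {n} {σ τ : Fin n → Fin n} → σ ≗ τ → IsPerm σ → IsPerm τ
perm-cong e (inj , sur) = (λ u v eq → inj u v (trans (e u) (trans eq (sym (e v))))) , surjective-cong e sur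

pre : ∀ {n} → (Fin n → Fin n) → Fin n → Fin n
pre σ v with any? (λ u → σ u ≟ v)
... | yes (u , _) = u
... | no _        = v

σ-pre : ∀ {n} {σ : Fin n → Fin n} → Surjective σ → ∀ v → σ (pre σ v) ≡ v
σ-pre {σ = σ} sur v with any? (λ u → σ u ≟ v)
... | yes (_ , e) = e
... | no none     = contradiction (sur v) none

pre-arc : ∀ {n} {adj : Digraph n} {σ : Fin n → Fin n} → Surjective σ → Bidirected adj →
          (∀ v → adj v (σ v) ≡ true) → ∀ v → adj v (pre σ v) ≡ true
pre-arc {adj = adj} {σ} sur bi arcs v =
  bi _ _ (subst (λ w → adj (pre σ v) w ≡ true) (σ-pre sur v) (arcs (pre σ v)))

pre-unique : ∀ {n} {σ : Fin n → Fin n} → IsPerm σ → ∀ {u v} → σ u ≡ v → pre σ v ≡ u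
pre-unique (inj , sur) {u} {v} e = inj _ _ (trans (σ-pre sur v) (sym e))

pre-σ : ∀ {n} {σ : Fin n → Fin n} → IsPerm σ → ∀ u → pre σ (σ u) ≡ u
pre-σ perm u = pre-unique perm refl

pre-cong : ∀ {n} {σ τ : Fin n → Fin n} → IsPerm σ → σ ≗ τ → pre σ ≗ pre τ
pre-cong perm e v = sym (pre-unique (perm-cong e perm) (trans (sym (e _)) (σ-pre (proj₂ perm) v)))

reach-pre : ∀ {n} {σ : Fin n → Fin n} → IsPerm σ → ∀ {u v} → Reach (pre σ) u v ⇔ Reach σ u v
reach-pre {σ = σ} perm@(inj , sur) =
  mk⇔ (reach-inverse (σ-pre sur) inj)
      (reach-inverse (pre-σ perm) (λ x y e → trans (sym (σ-pre sur x)) (trans (cong σ e) (σ-pre sur y))))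

-- Reversal on a set t of vertices.  reverseOn t σ runs the cycles of σ
-- inside t backwards; advanceOn t σ moves the vertices of t one step
-- forward, so shiftOn t σ g puts a label that sat on the arc u → σ u
-- (u ∈ t) on the reversed arc σ u → u, which leaves σ u.

reverseOn : ∀ {n} → (Fin n → Bool) → (Fin n → Fin n) → Fin n → Fin n
reverseOn t σ v = if t v then pre σ v else σ v

advanceOn retreatOn : ∀ {n} → (Fin n → Bool) → (Fin n → Fin n) → Fin n → Fin n
advanceOn t σ v = if t v then σ v else v
retreatOn t σ v = if t v then pre σ v else v

shiftOn : ∀ {n k} → (Fin n → Bool) → (Fin n → Fin n) → (Fin k → Fin n) → Fin k → Fin n
shiftOn t σ g = advanceOn t σ ∘ g

reverseOn-cong : ∀ {n} {t t′ : Fin n → Bool} {σ τ : Fin n → Fin n} → IsPerm σ → t ≗ t′ → σ ≗ τ →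
                 reverseOn t σ ≗ reverseOn t′ τ
reverseOn-cong {t = t} {t′} perm et e v with t v | t′ v | et v
... | true  | .true  | refl = pre-cong perm e v
... | false | .false | refl = e v

advanceOn-cong : ∀ {n} {t t′ : Fin n → Bool} {σ τ : Fin n → Fin n} → t ≗ t′ → σ ≗ τ →
                 advanceOn t σ ≗ advanceOn t′ τ
advanceOn-cong {t = t} {t′} et e v with t v | t′ v | et v
... | true  | .true  | refl = e v
... | false | .false | refl = refl

shiftOn-cong : ∀ {n k} {t t′ : Fin n → Bool} {σ τ : Fin n → Fin n} {g h : Fin k → Fin n} →
               t ≗ t′ → σ ≗ τ → g ≗ h → shiftOn t σ g ≗ shiftOn t′ τ h
shiftOn-cong {t = t} {σ = σ} et e eg l = trans (cong (advanceOn t σ) (eg l)) (advanceOn-cong et e _)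

-- Throughout, t is a union of cycles of the permutation σ.
module Reversal {n : ℕ} (σ : Fin n → Fin n) (perm : IsPerm σ)
                (t : Fin n → Bool) (t-σ : ∀ v → t (σ v) ≡ t v) where

  σ′ : Fin n → Fin n
  σ′ = reverseOn t σ

  t-pre : ∀ v → t (pre σ v) ≡ t v
  t-pre v = trans (sym (t-σ (pre σ v))) (cong t (σ-pre (proj₂ perm) v))

  reverse-in : ∀ {v} → t v ≡ true → σ′ v ≡ pre σ v
  reverse-in = if-true

  reverse-out : ∀ {v} → t v ≡ false → σ′ v ≡ σ v
  reverse-out = if-false

  reverse-perm : IsPerm σ′
  reverse-perm = injective , surjective
    where
    injective : ∀ u w → σ′ u ≡ σ′ w → u ≡ w
    injective u w e with t u in tu | t w in tw
    ... | true  | true  = trans (sym (σ-pre (proj₂ perm) u)) (trans (cong σ e) (σ-pre (proj₂ perm) w))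
    ... | false | false = proj₁ perm u w e
    ... | true  | false with () ← trans (sym tu) (trans (sym (t-pre u)) (trans (cong t e) (trans (t-σ w) tw)))
    ... | false | true  with () ← trans (sym tw) (trans (sym (t-pre w)) (trans (cong t (sym e)) (trans (t-σ u) tu)))
    surjective : Surjective σ′
    surjective w with t w in tw
    ... | true  = σ w , trans (reverse-in (trans (t-σ w) tw)) (pre-σ perm w)
    ... | false = pre σ w , trans (reverse-out (trans (t-pre w) tw)) (σ-pre (proj₂ perm) w)

  reverse-cycleCover : ∀ {adj : Digraph n} → Bidirected adj → (∀ v → adj v (σ v) ≡ true) →
                       IsCycleCover adj σ′
  reverse-cycleCover {adj} bi arcs = arcs′ , reverse-perm
    where
    arcs′ : ∀ v → adj v (σ′ v) ≡ true
    arcs′ v with t v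
    ... | true  = pre-arc (proj₂ perm) bi arcs v
    ... | false = arcs v

  reverse-involutive : reverseOn t σ′ ≗ σ
  reverse-involutive v with t v in tv
  ... | true  = pre-unique reverse-perm (trans (reverse-in (trans (t-σ v) tv)) (pre-σ perm v))
  ... | false = refl

  retreat-advance : ∀ v → retreatOn t σ (advanceOn t σ v) ≡ v
  retreat-advance v with t v in tv
  ... | true  = trans (if-true (trans (t-σ v) tv)) (pre-σ perm v)
  ... | false = if-false tv

  advance-retreat : ∀ v → advanceOn t σ (retreatOn t σ v) ≡ v
  advance-retreat v with t v in tv
  ... | true  = trans (if-true (trans (t-pre v) tv)) (σ-pre (proj₂ perm) v)
  ... | false = if-false tv

  advance-reverse : advanceOn t σ′ ≗ retreatOn t σ
  advance-reverse v with t v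
  ... | true  = refl
  ... | false = refl

  shift-involutive : ∀ {k} (g : Fin k → Fin n) → shiftOn t σ′ (shiftOn t σ g) ≗ g
  shift-involutive g l = trans (advance-reverse (advanceOn t σ (g l))) (retreat-advance (g l))

  shift-surjective : ∀ {k} {g : Fin k → Fin n} → Surjective g → Surjective (shiftOn t σ g)
  shift-surjective sur w with sur (retreatOn t σ w)
  ... | l , e = l , trans (cong (advanceOn t σ) e) (advance-retreat w)

  shift-preimage : ∀ {k} (g : Fin k → Fin n) v →
                   preimage (shiftOn t σ g) v ≡ preimage g (retreatOn t σ v)
  shift-preimage g v = tabulate-cong (λ l → does-⇔ (moved l) (shiftOn t σ g l ≟ v) (g l ≟ retreatOn t σ v))
    where
    moved : ∀ l → shiftOn t σ g l ≡ v ⇔ g l ≡ retreatOn t σ v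
    moved l = mk⇔ (λ e → trans (sym (retreat-advance (g l))) (cong (retreatOn t σ) e))
                  (λ e → trans (cong (advanceOn t σ) e) (advance-retreat v))

  shift-fixed : ∀ {k} {g : Fin k → Fin n} → Surjective g → (∀ v → ¬ σ v ≡ v) →
                (∀ l → shiftOn t σ g l ≡ g l) → ∀ v → t v ≡ false
  shift-fixed {g = g} sur free fixed v with sur v
  ... | l , refl with t (g l) in tv
  ... | true  = contradiction (trans (sym (if-true tv)) (fixed l)) (free (g l))
  ... | false = refl

-- The least index satisfying a Boolean predicate; it depends on the
-- predicate only pointwise, which makes it a canonical choice.

firstTrue : ∀ {m} → (Fin m → Bool) → Maybe (Fin m)
firstTrue {zero}  p = nothing
firstTrue {suc m} p = if p zero then just zero else Maybe.map suc (firstTrue (p ∘ suc))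

firstTrue-cong : ∀ {m} {p q : Fin m → Bool} → p ≗ q → firstTrue p ≡ firstTrue q
firstTrue-cong {zero}          e = refl
firstTrue-cong {suc m} {p} {q} e rewrite e zero | firstTrue-cong {p = p ∘ suc} {q ∘ suc} (e ∘ suc) = refl

firstTrue-just : ∀ {m} (p : Fin m → Bool) {c} → firstTrue p ≡ just c → p c ≡ true
firstTrue-just {suc m} p e with p zero in p0 | firstTrue (p ∘ suc) in rest
firstTrue-just {suc m} p refl | true  | _       = p0
firstTrue-just {suc m} p refl | false | just c  = firstTrue-just (p ∘ suc) rest
firstTrue-just {suc m} p ()   | false | nothing

firstTrue-nothing : ∀ {m} (p : Fin m → Bool) → firstTrue p ≡ nothing → ∀ v → p v ≡ false
firstTrue-nothing {suc m} p e v with p zero in p0 | firstTrue (p ∘ suc) in rest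
firstTrue-nothing {suc m} p ()   v       | true  | _
firstTrue-nothing {suc m} p ()   v       | false | just _
firstTrue-nothing {suc m} p refl zero    | false | nothing = p0
firstTrue-nothing {suc m} p refl (suc v) | false | nothing = firstTrue-nothing (p ∘ suc) rest v

unreached : ∀ {n} → Fin n → (Fin n → Fin n) → Fin n → Bool
unreached s σ v = not (does (reach? σ s v))

pivot : ∀ {n} → Fin n → (Fin n → Fin n) → Maybe (Fin n)
pivot s σ = firstTrue (unreached s σ)

cycleOf : ∀ {n} → (Fin n → Fin n) → Maybe (Fin n) → Fin n → Bool
cycleOf σ nothing  v = false
cycleOf σ (just c) v = does (reach? σ c v)

pivotCycle : ∀ {n} → Fin n → (Fin n → Fin n) → Fin n → Bool
pivotCycle s σ = cycleOf σ (pivot s σ)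

module _ {n : ℕ} (s : Fin n) {σ τ : Fin n → Fin n} (e : σ ≗ τ) where

  private
    same-orbits : ∀ {u v} → Reach σ u v ⇔ Reach τ u v
    same-orbits = reach-agree (λ i → sym (e _))

  pivot-cong : pivot s σ ≡ pivot s τ
  pivot-cong = firstTrue-cong (λ v → cong not (does-⇔ same-orbits (reach? σ s v) (reach? τ s v)))

  pivotCycle-cong : pivotCycle s σ ≗ pivotCycle s τ
  pivotCycle-cong v = trans (cong (λ m → cycleOf σ m v) pivot-cong) (cycleOf-cong (pivot s τ))
    where
    cycleOf-cong : ∀ m → cycleOf σ m v ≡ cycleOf τ m v
    cycleOf-cong nothing  = refl
    cycleOf-cong (just c) = does-⇔ same-orbits (reach? σ c v) (reach? τ c v)

module PivotCycle {n : ℕ} (s : Fin n) (σ : Fin n → Fin n) (perm : IsPerm σ) where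

  private
    inj : ∀ u v → σ u ≡ σ v → u ≡ v
    inj = proj₁ perm

  pivot-unreached : ∀ {c} → pivot s σ ≡ just c → ¬ Reach σ s c
  pivot-unreached {c} e r
    with () ← trans (sym (cong not (dec-true (reach? σ s c) r))) (firstTrue-just (unreached s σ) e)

  pivot-nothing : pivot s σ ≡ nothing → ∀ v → Reach σ s v
  pivot-nothing e v with reach? σ s v | firstTrue-nothing (unreached s σ) e v
  ... | yes r | _  = r
  ... | no _  | ()

  hamiltonian-pivot : does (isHamiltonian? σ) ≡ not (is-just (pivot s σ))
  hamiltonian-pivot = by-pivot (pivot s σ) refl
    where
    by-pivot : ∀ m → pivot s σ ≡ m → does (isHamiltonian? σ) ≡ not (is-just m)
    by-pivot nothing  e = dec-true (isHamiltonian? σ)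
      (λ u v → reach-trans σ (reach-sym σ inj (pivot-nothing e u)) (pivot-nothing e v))
    by-pivot (just c) e = dec-false (isHamiltonian? σ) (λ ham → pivot-unreached e (ham s c))

  t : Fin n → Bool
  t = pivotCycle s σ

  cycle-σ : ∀ v → t (σ v) ≡ t v
  cycle-σ v = by-pivot (pivot s σ)
    where
    by-pivot : ∀ m → cycleOf σ m (σ v) ≡ cycleOf σ m v
    by-pivot nothing  = refl
    by-pivot (just c) = does-⇔ (mk⇔ (λ r → reach-trans σ r (reach-sym σ inj (shorten σ 1 refl)))
                                    (reach-step σ))
                               (reach? σ c (σ v)) (reach? σ c v)

  s-off-cycle : t s ≡ false
  s-off-cycle = by-pivot (pivot s σ) refl
    where
    by-pivot : ∀ m → pivot s σ ≡ m → cycleOf σ m s ≡ false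
    by-pivot nothing  _ = refl
    by-pivot (just c) e = dec-false (reach? σ c s) (λ r → pivot-unreached e (reach-sym σ inj r))

  pivot-on-cycle : ∀ {c} → pivot s σ ≡ just c → t c ≡ true
  pivot-on-cycle {c} e = trans (cong (λ m → cycleOf σ m c) e) (dec-true (reach? σ c c) (reach-refl σ c))

  cycle-nonempty : T (is-just (pivot s σ)) → ∃ λ c → t c ≡ true
  cycle-nonempty = by-pivot (pivot s σ) refl
    where
    by-pivot : ∀ m → pivot s σ ≡ m → T (is-just m) → ∃ λ c → t c ≡ true
    by-pivot (just c) e _  = c , pivot-on-cycle e
    by-pivot nothing  _ ()

  open Reversal σ perm t cycle-σ public

  -- Reversing the pivot cycle changes neither the pivot nor its cycle:
  -- σ′ agrees with σ on the orbit of s, and with σ⁻¹ on the pivot cycle.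
  pivot-reverse : pivot s σ′ ≡ pivot s σ
  pivot-reverse = firstTrue-cong (λ v → cong not (does-⇔ (⇔-sym (reach-agree agree)) (reach? σ′ s v) (reach? σ s v)))
    where
    off : ∀ i → t (iter σ i s) ≡ false
    off zero    = s-off-cycle
    off (suc i) = trans (cycle-σ _) (off i)
    agree : ∀ i → σ′ (iter σ i s) ≡ σ (iter σ i s)
    agree i = reverse-out (off i)

  cycle-reverse : pivotCycle s σ′ ≗ t
  cycle-reverse v = trans (cong (λ m → cycleOf σ′ m v) pivot-reverse) (by-pivot (pivot s σ) refl)
    where
    by-pivot : ∀ m → pivot s σ ≡ m → cycleOf σ′ m v ≡ cycleOf σ m v
    by-pivot nothing  _ = refl
    by-pivot (just c) e = does-⇔ (reach-pre perm ⇔-∘ ⇔-sym (reach-agree agree)) (reach? σ′ c v) (reach? σ c v)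
      where
      on : ∀ i → t (iter (pre σ) i c) ≡ true
      on zero    = pivot-on-cycle e
      on (suc i) = trans (t-pre _) (on i)
      agree : ∀ i → σ′ (iter (pre σ) i c) ≡ pre σ (iter (pre σ) i c)
      agree i = reverse-in (on i)

-- Pairs of functions, up to pointwise equality, are enumerated by codes in
-- Fin (m₁ ^ n₁ * m₂ ^ n₂); the code of a function is funToFin.

funToFin-cong : ∀ {n m} {σ τ : Fin n → Fin m} → σ ≗ τ → funToFin σ ≡ funToFin τ
funToFin-cong {zero}  e = refl
funToFin-cong {suc n} e = cong₂ combine (e zero) (funToFin-cong (e ∘ suc))

finToFun-combine : ∀ {n m} (i : Fin m) (r : Fin (m ℕ.^ n)) →
                   finToFun {m} {suc n} (combine i r) ≗ (i VF.∷ finToFun r)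
finToFun-combine {n} {m} i r zero    = cong proj₁ (remQuot-combine {m} {m ℕ.^ n} i r)
finToFun-combine {n} {m} i r (suc x) = cong (λ q → finToFun (proj₂ q) x) (remQuot-combine {m} {m ℕ.^ n} i r)

module FunPairs (n₁ m₁ n₂ m₂ : ℕ) where

  FunPair : Set
  FunPair = (Fin n₁ → Fin m₁) × (Fin n₂ → Fin m₂)

  _≅_ : FunPair → FunPair → Set
  (σ , g) ≅ (τ , h) = σ ≗ τ × g ≗ h

  ≅-reflexive : ∀ {x y} → x ≡ y → x ≅ y
  ≅-reflexive refl = (λ _ → refl) , (λ _ → refl)

  ≅-sym : ∀ {x y} → x ≅ y → y ≅ x
  ≅-sym (e , e′) = (λ v → sym (e v)) , (λ v → sym (e′ v))

  ≅-trans : ∀ {x y z} → x ≅ y → y ≅ z → x ≅ z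
  ≅-trans (e₁ , e₁′) (e₂ , e₂′) = (λ v → trans (e₁ v) (e₂ v)) , (λ v → trans (e₁′ v) (e₂′ v))

  N₁ N₂ size : ℕ
  N₁   = m₁ ℕ.^ n₁
  N₂   = m₂ ℕ.^ n₂
  size = N₁ ℕ.* N₂

  decode : Fin size → FunPair
  decode p = finToFun (quotient N₂ p) , finToFun (remainder {N₁} N₂ p)

  encode : FunPair → Fin size
  encode (σ , g) = combine (funToFin σ) (funToFin g)

  decode-combine : ∀ i r → decode (combine i r) ≡ (finToFun i , finToFun r)
  decode-combine i r = cong (λ q → finToFun (proj₁ q) , finToFun (proj₂ q))
                            (remQuot-combine {N₁} {N₂} i r)

  decode-encode : ∀ x → decode (encode x) ≅ x
  decode-encode (σ , g) = ≅-trans (≅-reflexive (decode-combine (funToFin σ) (funToFin g)))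
                                  (finToFun-funToFin σ , finToFun-funToFin g)

  encode-decode : ∀ p → encode (decode p) ≡ p
  encode-decode p = trans (cong₂ combine (funToFin-finToFin {n₁} {m₁} _) (funToFin-finToFin {n₂} {m₂} _))
                          (combine-remQuot {N₁} N₂ p)

  encode-cong : ∀ {x y} → x ≅ y → encode x ≡ encode y
  encode-cong (e , e′) = cong₂ combine (funToFin-cong e) (funToFin-cong e′)

foldr-tabulate : ∀ {a ℓ x} (M : Monoid a ℓ) {m} {X : Set x} (G : Fin m → X) (h : X → Monoid.Carrier M) →
                 List.foldr (λ y r → Monoid._∙_ M (h y) r) (Monoid.ε M) (List.tabulate G)
                   ≡ MonoidSum.sum M (h ∘ G)
foldr-tabulate M {zero}  G h = refl
foldr-tabulate M {suc m} G h = cong (Monoid._∙_ M (h (G zero))) (foldr-tabulate M (G ∘ suc) h)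

module Sums {c ℓ : Level} (R : CommutativeRing c ℓ) where

  open CommutativeRing R hiding (zero; refl; sym; trans; reflexive)
  open CommutativeRing R using () renaming (refl to ≈-refl; sym to ≈-sym; trans to ≈-trans; reflexive to ≈-reflexive)
  open import Algebra.Properties.CommutativeMonoid.Sum +-commutativeMonoid
    using (sum; sum-cong-≋; ∑-distrib-+; ∑-permute)
  open import Algebra.Properties.CommutativeSemigroup +-commutativeSemigroup using (interchange)
  open SetoidReasoning setoid

  ΣL : ∀ {a} {X : Set a} → List X → (X → Carrier) → Carrier
  ΣL = sumL R

  sumL-cong : ∀ {a} {X : Set a} (xs : List X) {h h′ : X → Carrier} →
              (∀ x → h x ≈ h′ x) → ΣL xs h ≈ ΣL xs h′
  sumL-cong []       e = ≈-refl
  sumL-cong (x ∷ xs) e = +-cong (e x) (sumL-cong xs e)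

  sumL-++ : ∀ {a} {X : Set a} (xs ys : List X) (h : X → Carrier) → ΣL (xs ++ ys) h ≈ ΣL xs h + ΣL ys h
  sumL-++ []       ys h = ≈-sym (+-identityˡ _)
  sumL-++ (x ∷ xs) ys h = ≈-trans (+-congˡ (sumL-++ xs ys h)) (≈-sym (+-assoc _ _ _))

  sumL-concatMap : ∀ {a b} {X : Set a} {Y : Set b} (G : X → List Y) (xs : List X) (h : Y → Carrier) →
                   ΣL (concatMap G xs) h ≈ ΣL xs (λ x → ΣL (G x) h)
  sumL-concatMap G []       h = ≈-refl
  sumL-concatMap G (x ∷ xs) h = ≈-trans (sumL-++ (G x) (concatMap G xs) h) (+-congˡ (sumL-concatMap G xs h))

  sumL-map : ∀ {a b} {X : Set a} {Y : Set b} (G : X → Y) (xs : List X) (h : Y → Carrier) →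
             ΣL (map G xs) h ≡ ΣL xs (h ∘ G)
  sumL-map G []       h = refl
  sumL-map G (x ∷ xs) h = cong (h (G x) +_) (sumL-map G xs h)

  sumL-filter : ∀ {a p} {X : Set a} {P : X → Set p} (P? : ∀ x → Dec (P x)) (xs : List X) (h : X → Carrier) →
                ΣL (filter P? xs) h ≈ ΣL xs (λ x → if does (P? x) then h x else 0#)
  sumL-filter P? []       h = ≈-refl
  sumL-filter P? (x ∷ xs) h with does (P? x)
  ... | true  = +-congˡ (sumL-filter P? xs h)
  ... | false = ≈-trans (sumL-filter P? xs h) (≈-sym (+-identityˡ _))

  sumL-+ : ∀ {a} {X : Set a} (xs : List X) (h h′ : X → Carrier) →
           ΣL xs (λ x → h x + h′ x) ≈ ΣL xs h + ΣL xs h′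
  sumL-+ []       h h′ = ≈-sym (+-identityˡ _)
  sumL-+ (x ∷ xs) h h′ = ≈-trans (+-congˡ (sumL-+ xs h h′)) (interchange _ _ _ _)

  sumL-0 : ∀ {a} {X : Set a} (xs : List X) → ΣL xs (λ _ → 0#) ≈ 0#
  sumL-0 []       = ≈-refl
  sumL-0 (x ∷ xs) = ≈-trans (+-identityˡ _) (sumL-0 xs)

  ∑-↑ : ∀ K M (F : Fin (K ℕ.+ M) → Carrier) → sum F ≈ sum (F ∘ (_↑ˡ M)) + sum (F ∘ (K ↑ʳ_))
  ∑-↑ zero    M F = ≈-sym (+-identityˡ _)
  ∑-↑ (suc K) M F = ≈-trans (+-congˡ (∑-↑ K M (F ∘ suc))) (≈-sym (+-assoc _ _ _))

  ∑-combine : ∀ m K (F : Fin (m ℕ.* K) → Carrier) → sum F ≈ sum {m} (λ i → sum {K} (λ r → F (combine i r)))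
  ∑-combine zero    K F = ≈-refl
  ∑-combine (suc m) K F = ≈-trans (∑-↑ K (m ℕ.* K) F) (+-congˡ (∑-combine m K (λ j → F (K ↑ʳ j))))

  sumL-allFuns : ∀ n m (h : (Fin n → Fin m) → Carrier) → (∀ {σ τ} → σ ≗ τ → h σ ≈ h τ) →
                 ΣL (allFuns n m) h ≈ sum (h ∘ finToFun)
  sumL-allFuns zero    m h h-cong = +-congʳ (h-cong (λ ()))
  sumL-allFuns (suc n) m h h-cong = begin
    ΣL (allFuns (suc n) m) h
      ≈⟨ sumL-concatMap _ (allFin m) h ⟩
    ΣL (allFin m) (λ i → ΣL (map (i VF.∷_) (allFuns n m)) h)
      ≈⟨ sumL-cong (allFin m) (λ i → ≈-reflexive (sumL-map (i VF.∷_) (allFuns n m) h)) ⟩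
    ΣL (allFin m) (λ i → ΣL (allFuns n m) (h ∘ (i VF.∷_)))
      ≈⟨ sumL-cong (allFin m) (λ i → sumL-allFuns n m _ (h-cong ∘ ∷-cong i)) ⟩
    ΣL (allFin m) (λ i → sum (λ r → h (i VF.∷ finToFun r)))
      ≡⟨ foldr-tabulate +-monoid {m} id (λ i → sum (λ r → h (i VF.∷ finToFun r))) ⟩
    sum {m} (λ i → sum (λ r → h (i VF.∷ finToFun r)))
      ≈⟨ sum-cong-≋ (λ i → sum-cong-≋ (λ r → h-cong (λ x → sym (finToFun-combine {n} {m} i r x)))) ⟩
    sum {m} (λ i → sum (λ r → h (finToFun (combine {m} {m ℕ.^ n} i r))))
      ≈⟨ ≈-sym (∑-combine m (m ℕ.^ n) (h ∘ finToFun)) ⟩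
    sum (h ∘ finToFun) ∎
    where
    ∷-cong : ∀ i {σ τ : Fin n → Fin m} → σ ≗ τ → (i VF.∷ σ) ≗ (i VF.∷ τ)
    ∷-cong i e zero    = refl
    ∷-cong i e (suc x) = e x

  sumL-if : ∀ b {a} {X : Set a} (xs : List X) (h : X → Carrier) →
            ΣL xs (λ x → if b then h x else 0#) ≈ (if b then ΣL xs h else 0#)
  sumL-if true  xs h = ≈-refl
  sumL-if false xs h = sumL-0 xs

  if-congˡ : ∀ b {x y z : Carrier} → x ≈ y → (if b then x else z) ≈ (if b then y else z)
  if-congˡ true  e = e
  if-congˡ false e = ≈-refl

  split-not : ∀ b x → x ≈ (if not b then x else 0#) + (if b then x else 0#)
  split-not true  x = ≈-sym (+-identityˡ x)
  split-not false x = ≈-sym (+-identityʳ x)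

  module _ (two : CharTwo R) where

    x+x≈0 : ∀ x → x + x ≈ 0#
    x+x≈0 x = begin
      x + x            ≈⟨ ≈-sym (+-cong (*-identityˡ x) (*-identityˡ x)) ⟩
      1# * x + 1# * x  ≈⟨ ≈-sym (distribʳ x 1# 1#) ⟩
      (1# + 1#) * x    ≈⟨ *-congʳ two ⟩
      0# * x           ≈⟨ zeroˡ x ⟩
      0#               ∎

    -- A sum over Fin N vanishes if an involution of the indices preserves
    -- the summands and fixes only zero summands: the terms come in pairs
    -- {j , ι j} of equal elements, each pair counted at its smaller index.
    cancel-Fin : ∀ {N} (w : Fin N → Carrier) (ι : Fin N → Fin N) → (∀ j → ι (ι j) ≡ j) →
                 (∀ j → w (ι j) ≈ w j) → (∀ j → ι j ≡ j → w j ≈ 0#) → sum w ≈ 0#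
    cancel-Fin {N} w ι invol w-ι w-fix = begin
      sum w                       ≈⟨ sum-cong-≋ split ⟩
      sum (λ j → u j + u (ι j))   ≈⟨ ∑-distrib-+ u (u ∘ ι) ⟩
      sum u + sum (u ∘ ι)         ≈⟨ +-congˡ (≈-sym (∑-permute u (permutation ι ι invol invol))) ⟩
      sum u + sum u               ≈⟨ x+x≈0 (sum u) ⟩
      0#                          ∎
      where
      lower : Fin N → Fin N → Carrier
      lower x y = if does (x <? y) then w x else 0#

      lower-< : ∀ {x y} → x Fin.< y → lower x y ≡ w x
      lower-< {x} {y} x<y = if-true (dec-true (x <? y) x<y)

      lower-≮ : ∀ {x y} → ¬ x Fin.< y → lower x y ≡ 0#
      lower-≮ {x} {y} x≮y = if-false (dec-false (x <? y) x≮y)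

      pair : ∀ x y → w y ≈ w x → (x ≡ y → w x ≈ 0#) → w x ≈ lower x y + lower y x
      pair x y wy fix with <-cmp x y
      ... | tri< x<y _ y≮x = ≈-sym (≈-trans (+-cong (≈-reflexive (lower-< x<y)) (≈-reflexive (lower-≮ y≮x)))
                                            (+-identityʳ _))
      ... | tri≈ x≮y x≡y y≮x = ≈-sym (≈-trans (+-cong (≈-reflexive (lower-≮ x≮y)) (≈-reflexive (lower-≮ y≮x)))
                                              (≈-trans (+-identityˡ _) (≈-sym (fix x≡y))))
      ... | tri> x≮y _ y<x = ≈-sym (≈-trans (+-cong (≈-reflexive (lower-≮ x≮y)) (≈-reflexive (lower-< y<x)))
                                            (≈-trans (+-identityˡ _) wy))

      u : Fin N → Carrier
      u j = lower j (ι j)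

      split : ∀ j → w j ≈ u j + u (ι j)
      split j = ≈-trans (pair j (ι j) (w-ι j) (λ e → w-fix j (sym e)))
                        (+-congˡ (≈-reflexive (cong (lower (ι j)) (sym (invol j)))))

  module _ {n₁ m₁ n₂ m₂ : ℕ} where
    open FunPairs n₁ m₁ n₂ m₂

    sumL-pairs : (W : FunPair → Carrier) → (∀ {x y} → x ≅ y → W x ≈ W y) →
                 ΣL (allFuns n₁ m₁) (λ σ → ΣL (allFuns n₂ m₂) (λ g → W (σ , g))) ≈ sum (W ∘ decode)
    sumL-pairs W W-cong = begin
      ΣL (allFuns n₁ m₁) (λ σ → ΣL (allFuns n₂ m₂) (λ g → W (σ , g)))
        ≈⟨ sumL-allFuns n₁ m₁ _ (λ e → sumL-cong (allFuns n₂ m₂) (λ g → W-cong (e , λ _ → refl))) ⟩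
      sum {N₁} (λ i → ΣL (allFuns n₂ m₂) (λ g → W (finToFun i , g)))
        ≈⟨ sum-cong-≋ (λ i → sumL-allFuns n₂ m₂ (λ g → W (finToFun i , g)) (λ e → W-cong ((λ _ → refl) , e))) ⟩
      sum {N₁} (λ i → sum {N₂} (λ r → W (finToFun i , finToFun r)))
        ≈⟨ sum-cong-≋ (λ i → sum-cong-≋ (λ r → ≈-reflexive (cong W (sym (decode-combine i r))))) ⟩
      sum {N₁} (λ i → sum {N₂} (λ r → W (decode (combine i r))))
        ≈⟨ ≈-sym (∑-combine N₁ N₂ (W ∘ decode)) ⟩
      sum (W ∘ decode) ∎

    cancel-pairs : CharTwo R → (W : FunPair → Carrier) (ι : FunPair → FunPair) →
                   (∀ {x y} → x ≅ y → ι x ≅ ι y) → (∀ x → ι (ι x) ≅ x) →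
                   (∀ {x y} → x ≅ y → W x ≈ W y) → (∀ x → W (ι x) ≈ W x) → (∀ x → ι x ≅ x → W x ≈ 0#) →
                   ΣL (allFuns n₁ m₁) (λ σ → ΣL (allFuns n₂ m₂) (λ g → W (σ , g))) ≈ 0#
    cancel-pairs two W ι ι-cong ι-invol W-cong W-ι W-fix =
      ≈-trans (sumL-pairs W W-cong) (cancel-Fin two (W ∘ decode) ι′ invol′ w-ι′ w-fix′)
      where
      ι′ : Fin size → Fin size
      ι′ p = encode (ι (decode p))

      invol′ : ∀ p → ι′ (ι′ p) ≡ p
      invol′ p = trans (encode-cong (≅-trans (ι-cong (decode-encode _)) (ι-invol _))) (encode-decode p)

      w-ι′ : ∀ p → W (decode (ι′ p)) ≈ W (decode p)
      w-ι′ p = ≈-trans (W-cong (decode-encode _)) (W-ι _)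

      w-fix′ : ∀ p → ι′ p ≡ p → W (decode p) ≈ 0#
      w-fix′ p e = W-fix _ (≅-trans (≅-sym (decode-encode _)) (≅-reflexive (cong decode e)))

preimage-nonempty : ∀ {k n} {g : Fin k → Fin n} → Surjective g → ∀ v → Nonempty (preimage g v)
preimage-nonempty {g = g} sur v with sur v
... | l , e = l , lookup⇒[]= l (preimage g v) (trans (lookup∘tabulate _ l) (dec-true (g l ≟ v) e))

module Weights {c ℓ : Level} (R : CommutativeRing c ℓ) where

  open CommutativeRing R hiding (zero; refl; sym; trans; reflexive)
  open CommutativeRing R using () renaming (sym to ≈-sym; trans to ≈-trans; reflexive to ≈-reflexive)
  open import Algebra.Properties.CommutativeMonoid.Sum *-commutativeMonoid
    using () renaming (sum to ∏; sum-cong-≋ to ∏-cong; ∑-permute to ∏-permute)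
  open SetoidReasoning setoid

  prodFin-∏ : ∀ {n} (F : Fin n → Carrier) → prodFin R F ≡ ∏ F
  prodFin-∏ = foldr-tabulate *-monoid id

  prodFin-cong : ∀ {n} {F G : Fin n → Carrier} → (∀ v → F v ≈ G v) → prodFin R F ≈ prodFin R G
  prodFin-cong {F = F} {G} e = ≈-trans (≈-reflexive (prodFin-∏ F)) (≈-trans (∏-cong e) (≈-reflexive (sym (prodFin-∏ G))))

  prodFin-permute : ∀ {n} (F : Fin n → Carrier) (ρ ρ⁻ : Fin n → Fin n) →
                    (∀ v → ρ (ρ⁻ v) ≡ v) → (∀ v → ρ⁻ (ρ v) ≡ v) → prodFin R (F ∘ ρ) ≈ prodFin R F
  prodFin-permute F ρ ρ⁻ inv inv′ = begin
    prodFin R (F ∘ ρ)  ≡⟨ prodFin-∏ (F ∘ ρ) ⟩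
    ∏ (F ∘ ρ)          ≈⟨ ≈-sym (∏-permute F (permutation ρ ρ⁻ inv inv′)) ⟩
    ∏ F                ≡⟨ sym (prodFin-∏ F) ⟩
    prodFin R F        ∎

  weight : ∀ {n k} → (Fin n → Fin n → Subset k → Carrier) → (Fin n → Fin n) → (Fin k → Fin n) → Carrier
  weight f σ g = prodFin R (λ v → f v (σ v) (preimage g v))

  weight-cong : ∀ {n k} (f : Fin n → Fin n → Subset k → Carrier) {σ τ : Fin n → Fin n} {g h : Fin k → Fin n} →
                σ ≗ τ → g ≗ h → weight f σ g ≈ weight f τ h
  weight-cong f e eg = prodFin-cong (λ v → ≈-reflexive
    (cong₂ (f v) (e v) (tabulate-cong (λ l → cong (λ w → does (w ≟ v)) (eg l)))))

  -- Reversing a union t of cycles of σ that avoids s, and shifting the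
  -- labels along, preserves the weight: the factor of the reversed arc
  -- v → σ⁻¹ v equals that of σ⁻¹ v → v by the mirror property.
  module _ {n k : ℕ} {adj : Digraph n} {s : Fin n} {f : Fin n → Fin n → Subset k → Carrier}
           (mirror : MirrorFunction R adj s f) (bi : Bidirected adj)
           {σ : Fin n → Fin n} (cc : IsCycleCover adj σ)
           {t : Fin n → Bool} (t-σ : ∀ v → t (σ v) ≡ t v) (s-off : t s ≡ false) where

    open Reversal σ (proj₂ cc) t t-σ

    reverse-weight : ∀ {g : Fin k → Fin n} → Surjective g → weight f σ′ (shiftOn t σ g) ≈ weight f σ g
    reverse-weight {g} sur = begin
      weight f σ′ (shiftOn t σ g)  ≈⟨ prodFin-cong term ⟩
      prodFin R (F ∘ retreatOn t σ) ≈⟨ prodFin-permute F (retreatOn t σ) (advanceOn t σ) retreat-advance advance-retreat ⟩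
      prodFin R F                   ∎
      where
      F : Fin n → Carrier
      F u = f u (σ u) (preimage g u)

      not-s : ∀ {u} → t u ≡ true → ¬ u ≡ s
      not-s tu refl with () ← trans (sym tu) s-off

      term : ∀ v → f v (σ′ v) (preimage (shiftOn t σ g) v) ≈ F (retreatOn t σ v)
      term v with t v in tv
      ... | true = begin
        f v (pre σ v) (preimage (shiftOn t σ g) v)
          ≡⟨ cong (f v (pre σ v)) (trans (shift-preimage g v) (cong (preimage g) (if-true tv))) ⟩
        f v (pre σ v) (preimage g (pre σ v))
          ≈⟨ mirror v (pre σ v) (pre-arc (proj₂ (proj₂ cc)) bi (proj₁ cc) v) (not-s tv) (not-s (trans (t-pre v) tv))
                    (preimage g (pre σ v)) (preimage-nonempty sur (pre σ v)) ⟩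
        f (pre σ v) v (preimage g (pre σ v))
          ≡⟨ cong (λ w → f (pre σ v) w (preimage g (pre σ v))) (sym (σ-pre (proj₂ (proj₂ cc)) v)) ⟩
        F (pre σ v) ∎
      ... | false = ≈-reflexive (cong (f v (σ v)) (trans (shift-preimage g v) (cong (preimage g) (if-false tv))))

cover-moves : ∀ {n} {adj : Digraph n} {σ : Fin n → Fin n} → Loopless adj →
              (∀ v → adj v (σ v) ≡ true) → ∀ v → ¬ σ v ≡ v
cover-moves {adj = adj} lo arcs v e with () ← trans (sym (lo v)) (subst (λ w → adj v w ≡ true) e (arcs v))

module Cancellation {c ℓ : Level} (R : CommutativeRing c ℓ) {n k : ℕ}
                    (adj : Digraph n) (s : Fin n) (f : Fin n → Fin n → Subset k → CommutativeRing.Carrier R)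
                    (lo : Loopless adj) (bi : Bidirected adj) (mirror : MirrorFunction R adj s f) where

  open CommutativeRing R hiding (zero; refl; sym; trans; reflexive)
  open CommutativeRing R using () renaming (sym to ≈-sym; trans to ≈-trans; reflexive to ≈-reflexive)
  open Weights R
  open Sums R using (ΣL; sumL-cong; sumL-if; sumL-filter; if-congˡ; split-not)
  open FunPairs n n k n
  open SetoidReasoning setoid

  NonHamiltonian : (Fin n → Fin n) → Set
  NonHamiltonian σ = IsCycleCover adj σ × T (is-just (pivot s σ))

  nonHamiltonian? : ∀ σ → Dec (NonHamiltonian σ)
  nonHamiltonian? σ = isCycleCover? adj σ ×-dec T? (is-just (pivot s σ))

  Cancelled : FunPair → Set
  Cancelled (σ , g) = NonHamiltonian σ × Surjective g

  cancelled? : ∀ x → Dec (Cancelled x)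
  cancelled? (σ , g) = nonHamiltonian? σ ×-dec surjective? g

  flip : FunPair → FunPair
  flip (σ , g) = reverseOn (pivotCycle s σ) σ , shiftOn (pivotCycle s σ) σ g

  ι : FunPair → FunPair
  ι x = if does (cancelled? x) then flip x else x

  W : FunPair → Carrier
  W (σ , g) = if does (cancelled? (σ , g)) then weight f σ g else 0#

  ι-in : ∀ {x} → Cancelled x → ι x ≡ flip x
  ι-in {x} p = if-true (dec-true (cancelled? x) p)

  ι-out : ∀ {x} → ¬ Cancelled x → ι x ≡ x
  ι-out {x} ¬p = if-false (dec-false (cancelled? x) ¬p)

  W-in : ∀ {σ g} → Cancelled (σ , g) → W (σ , g) ≡ weight f σ g
  W-in {σ} {g} p = if-true (dec-true (cancelled? (σ , g)) p)

  W-out : ∀ {x} → ¬ Cancelled x → W x ≡ 0#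
  W-out {x} ¬p = if-false (dec-false (cancelled? x) ¬p)

  cancelled-cong : ∀ {x y} → x ≅ y → Cancelled x → Cancelled y
  cancelled-cong (e , eg) (((arcs , perm) , has-pivot) , sur) =
    (((λ v → subst (λ w → adj v w ≡ true) (e v) (arcs v)) , perm-cong e perm) ,
     subst (T ∘ is-just) (pivot-cong s e) has-pivot) ,
    surjective-cong eg sur

  flip-cong : ∀ {x y} → Cancelled x → x ≅ y → flip x ≅ flip y
  flip-cong (((_ , perm) , _) , _) (e , eg) =
    reverseOn-cong perm (pivotCycle-cong s e) e , shiftOn-cong (pivotCycle-cong s e) e eg

  module Flip {σ : Fin n → Fin n} {g : Fin k → Fin n} (p : Cancelled (σ , g)) where

    private
      cc : IsCycleCover adj σ
      cc = proj₁ (proj₁ p)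
      sur : Surjective g
      sur = proj₂ p

    open PivotCycle s σ (proj₂ cc)

    flip-cancelled : Cancelled (flip (σ , g))
    flip-cancelled = (reverse-cycleCover bi (proj₁ cc) , subst (T ∘ is-just) (sym pivot-reverse) (proj₂ (proj₁ p))) ,
                     shift-surjective sur

    -- the pivot cycle of σ′ is that of σ, and reversing it twice is the identity
    flip-involutive : flip (flip (σ , g)) ≅ (σ , g)
    flip-involutive = ≅-trans (reverseOn-cong {σ = σ′} reverse-perm cycle-reverse (λ _ → refl) ,
                               shiftOn-cong {σ = σ′} {g = shiftOn t σ g} cycle-reverse (λ _ → refl) (λ _ → refl))
                              (reverse-involutive , shift-involutive g)

    flip-weight : weight f σ′ (shiftOn t σ g) ≈ weight f σ g
    flip-weight = reverse-weight mirror bi cc cycle-σ s-off-cycle sur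

    -- σ moves every vertex of the (nonempty) pivot cycle, so flip moves a label
    flip-moves : ¬ flip (σ , g) ≅ (σ , g)
    flip-moves (_ , fixed) with cycle-nonempty (proj₂ (proj₁ p))
    ... | c , tc with () ← trans (sym tc) (shift-fixed sur (cover-moves {adj = adj} lo (proj₁ cc)) fixed c)

  open Flip

  ι-cong : ∀ {x y} → x ≅ y → ι x ≅ ι y
  ι-cong {x} {y} e = by (cancelled? x)
    where
    by : Dec (Cancelled x) → ι x ≅ ι y
    by (yes p) = ≅-trans (≅-reflexive (ι-in p))
                 (≅-trans (flip-cong p e) (≅-reflexive (sym (ι-in (cancelled-cong e p)))))
    by (no ¬p) = ≅-trans (≅-reflexive (ι-out ¬p))
                 (≅-trans e (≅-reflexive (sym (ι-out (¬p ∘ cancelled-cong (≅-sym e))))))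

  ι-involutive : ∀ x → ι (ι x) ≅ x
  ι-involutive x = by (cancelled? x)
    where
    by : Dec (Cancelled x) → ι (ι x) ≅ x
    by (yes p) = ≅-trans (≅-reflexive (trans (cong ι (ι-in p)) (ι-in (flip-cancelled p)))) (flip-involutive p)
    by (no ¬p) = ≅-reflexive (trans (cong ι (ι-out ¬p)) (ι-out ¬p))

  W-cong : ∀ {x y} → x ≅ y → W x ≈ W y
  W-cong {x} {y} e = by (cancelled? x)
    where
    by : Dec (Cancelled x) → W x ≈ W y
    by (yes p) = ≈-trans (≈-reflexive (W-in p))
                 (≈-trans (weight-cong f (proj₁ e) (proj₂ e)) (≈-reflexive (sym (W-in (cancelled-cong e p)))))
    by (no ¬p) = ≈-reflexive (trans (W-out ¬p) (sym (W-out (¬p ∘ cancelled-cong (≅-sym e)))))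

  W-ι : ∀ x → W (ι x) ≈ W x
  W-ι x = by (cancelled? x)
    where
    by : Dec (Cancelled x) → W (ι x) ≈ W x
    by (yes p) = ≈-trans (≈-reflexive (trans (cong W (ι-in p)) (W-in (flip-cancelled p))))
                         (≈-trans (flip-weight p) (≈-reflexive (sym (W-in p))))
    by (no ¬p) = ≈-reflexive (cong W (ι-out ¬p))

  W-fixed : ∀ x → ι x ≅ x → W x ≈ 0#
  W-fixed x fixed = by (cancelled? x)
    where
    by : Dec (Cancelled x) → W x ≈ 0#
    by (yes p) = contradiction (≅-trans (≅-reflexive (sym (ι-in p))) fixed) (flip-moves p)
    by (no ¬p) = ≈-reflexive (W-out ¬p)

  sum-W : ∀ σ → ΣL (allFuns k n) (λ g → W (σ , g)) ≈ (if does (nonHamiltonian? σ) then labelSum R k f σ else 0#)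
  sum-W σ = begin
    ΣL (allFuns k n) (λ g → W (σ , g))
      ≈⟨ sumL-cong (allFuns k n) (λ g → ≈-reflexive (if-∧ (does (nonHamiltonian? σ)))) ⟩
    ΣL (allFuns k n) (λ g → if does (nonHamiltonian? σ) then surjW g else 0#)
      ≈⟨ sumL-if (does (nonHamiltonian? σ)) (allFuns k n) surjW ⟩
    (if does (nonHamiltonian? σ) then ΣL (allFuns k n) surjW else 0#)
      ≈⟨ if-congˡ (does (nonHamiltonian? σ)) (≈-sym (sumL-filter surjective? (allFuns k n) (weight f σ))) ⟩
    (if does (nonHamiltonian? σ) then labelSum R k f σ else 0#) ∎
    where
    surjW : (Fin k → Fin n) → Carrier
    surjW g = if does (surjective? g) then weight f σ g else 0#

  split-covers : ∀ σ (x : Carrier) →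
    (if does (isCycleCover? adj σ) then x else 0#)
      ≈ (if does (isCycleCover? adj σ) ∧ does (isHamiltonian? σ) then x else 0#)
        + (if does (nonHamiltonian? σ) then x else 0#)
  split-covers σ x = by (isCycleCover? adj σ)
    where
    by : (d : Dec (IsCycleCover adj σ)) →
         (if does d then x else 0#)
           ≈ (if does d ∧ does (isHamiltonian? σ) then x else 0#) + (if does d ∧ is-just (pivot s σ) then x else 0#)
    by (no _)   = ≈-sym (+-identityˡ 0#)
    by (yes cc) rewrite PivotCycle.hamiltonian-pivot s σ (proj₂ cc) = split-not (is-just (pivot s σ)) x

lemma1 : ∀ {c ℓ : Level} (R : CommutativeRing c ℓ) (n k : ℕ)
           (adj : Digraph n) (s : Fin n)
           (f : Fin n → Fin n → Subset k → CommutativeRing.Carrier R) →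
           Loopless adj → Bidirected adj →
           MirrorFunction R adj s f → CharTwo R →
           CommutativeRing._≈_ R (Λ R k adj f) (HamΛ R k adj f)
lemma1 R n k adj s f lo bi mirror two = begin
  Λ R k adj f
    ≈⟨ sumL-filter (isCycleCover? adj) maps (labelSum R k f) ⟩
  ΣL maps (λ σ → if does (isCycleCover? adj σ) then labelSum R k f σ else 0#)
    ≈⟨ sumL-cong maps (λ σ → ≈-trans (split-covers σ (labelSum R k f σ)) (+-congˡ (≈-sym (sum-W σ)))) ⟩
  ΣL maps (λ σ → hamiltonian σ + ΣL labellings (λ g → W (σ , g)))
    ≈⟨ sumL-+ maps hamiltonian (λ σ → ΣL labellings (λ g → W (σ , g))) ⟩
  ΣL maps hamiltonian + ΣL maps (λ σ → ΣL labellings (λ g → W (σ , g)))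
    ≈⟨ +-cong (≈-sym (sumL-filter (λ σ → isCycleCover? adj σ ×-dec isHamiltonian? σ) maps (labelSum R k f)))
              (cancel-pairs two W ι ι-cong ι-involutive W-cong W-ι W-fixed) ⟩
  HamΛ R k adj f + 0#
    ≈⟨ +-identityʳ _ ⟩
  HamΛ R k adj f ∎
  where
  open CommutativeRing R using (Carrier; _+_; 0#; +-cong; +-congˡ; +-identityʳ; setoid)
    renaming (sym to ≈-sym; trans to ≈-trans)
  open Sums R using (ΣL; sumL-cong; sumL-filter; sumL-+; cancel-pairs)
  open Cancellation R adj s f lo bi mirror
  open SetoidReasoning setoid

  maps : List (Fin n → Fin n)
  maps = allFuns n n

  labellings : List (Fin k → Fin n)
  labellings = allFuns k n

  hamiltonian : (Fin n → Fin n) → Carrier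
  hamiltonian σ = if does (isCycleCover? adj σ) ∧ does (isHamiltonian? σ) then labelSum R k f σ else 0#
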